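{- Let $t \ge 2$ be an integer. Over the alphabet $\{{\tt 0},{\tt 1}\}$ define $y = {\tt 0}{\tt 1}^{t-1}{\tt 0}$ and $x_i = {\tt 1}^{t-i-1}{\tt 0}{\tt 1}^{i+1}$ for $0 \le i \le t-2$, and let $S_t = \{{\tt 0}, x_0, x_1, \ldots, x_{t-2}, y\}$. Then $\mathrm{sc}(S_t^*) \ge 2^{t-2}$.
   Context: For a regular language $L$ over $\{{\tt 0},{\tt 1}\}$, $\mathrm{sc}(L)$ is the number of states of the minimal (complete) DFA accepting $L$. -}

module Defs where

open import Data.Nat using (ℕ; suc; _+_; _∸_; _<_; _≤_)
open import Data.Bool using (Bool; true; false)
open import Data.Fin using (Fin)
open import Data.List using (List; []; _∷_; _++_; replicate; foldl)
open import Data.Product using (Σ; _×_; ∃-syntax)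
open import Data.Sum using (_⊎_)
open import Relation.Binary.PropositionalEquality using (_≡_)
open import Function.Bundles using (_⇔_)

data Bit : Set where
  𝟘 𝟙 : Bit

Word : Set
Word = List Bit

Language : Set₁
Language = Word → Set

data Star (L : Language) : Language where
  ε-mem : Star L []
  cat   : ∀ {u w} → L u → Star L w → Star L (u ++ w)

record DFA (n : ℕ) : Set where
  field
    δ      : Fin n → Bit → Fin n
    start  : Fin n
    final  : Fin n → Bool

  run : Fin n → Word → Fin n
  run q [] = q
  run q (a ∷ w) = run (δ q a) w

  accepts : Word → Set
  accepts w = final (run start w) ≡ true

Recognises : ∀ {n} → DFA n → Language → Set
Recognises D L = ∀ w → (DFA.accepts D w ⇔ L w)

-- sc(L) ≥ k : every complete DFA recognising L has at least k states
-- (equivalently, the minimal complete DFA for L has ≥ k states).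
ScAtLeast : Language → ℕ → Set
ScAtLeast L k = ∀ n (D : DFA n) → Recognises D L → k ≤ n

yWord : ℕ → Word
yWord t = 𝟘 ∷ replicate (t ∸ 1) 𝟙 ++ 𝟘 ∷ []

xWord : ℕ → ℕ → Word
xWord t i = replicate (t ∸ i ∸ 1) 𝟙 ++ 𝟘 ∷ replicate (suc i) 𝟙

S : ℕ → Language
S t w = (w ≡ 𝟘 ∷ []) ⊎ (w ≡ yWord t) ⊎ (∃[ i ] (suc i < t × w ≡ xWord t i))

-- For a word w ending in 𝟘 let R(w) = { m | w 1^m ∈ S_t* }.  In a factorisation of w 1^m with
-- m ≥ 1 the last factor is some x_i; hence for m ∈ [1,t) appending the block 1^(t-1)𝟘 to w moves
-- m-1 ∈ R(w) to m, while appending 1^t𝟘 keeps R(w) ∩ [1,t) and removes 0.  Since moreover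
-- 0 ∈ R(w 1^(t-1)𝟘) whenever t-1 ∈ R(w), the two blocks push a bit 1 resp. 0 into R viewed as a
-- shift register.  From a word P with [0,t) ⊆ R(P) (obtained by iterating full rotations of R,
-- each of which also adds 0 through a y-piece), pushing t-1 bits gives 2^(t-1) words with pairwise
-- different R ∩ [0,t-1), which therefore reach pairwise different states of any DFA for S_t*.
module Submission where

open import Defs
open import Data.Nat using (ℕ; zero; suc; _+_; _∸_; _≤_; _<_; z≤n; s≤s; _^_)
open import Data.Nat.Properties
  using (suc-injective; +-suc; +-comm; +-identityʳ; +-cancelʳ-≡; m+n∸n≡m; ∸-+-assoc; m<n+m; m+1+n≢n;
         1+n≢n; m≤n⇒∃[o]m+o≡n; ^-monoʳ-≤; ≤-refl; ≤-trans; ≤-pred; n≤1+n; <-≤-trans; m<n⇒m<1+n)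
open import Data.Fin using (Fin; zero; suc; toℕ; combine; finToFun; funToFin)
open import Data.Fin.Properties using (toℕ<n; injective⇒≤; funToFin-finToFin)
open import Data.List using ([]; _∷_; _++_; replicate; length)
open import Data.List.Properties
  using (++-assoc; ++-identityʳ; ++-conicalʳ; ∷-injective; ∷-injectiveʳ; length-replicate)
open import Data.Product using (∃-syntax; ∃₂; _×_; _,_; proj₁; proj₂)
open import Data.Sum using (_⊎_; inj₁; inj₂)
open import Data.Bool using (true)
open import Data.Empty using (⊥-elim)
open import Function using (_∘_)
open import Function.Bundles using (Equivalence; _⇔_; mk⇔)
open import Function.Properties.Equivalence using () renaming (sym to ⇔-sym; trans to ⇔-trans)
open import Relation.Nullary using (¬_)
open import Relation.Binary.PropositionalEquality
  using (_≡_; _≢_; refl; sym; trans; cong; cong₂; subst; subst₂; _≗_; module ≡-Reasoning)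

1s : ℕ → Word
1s n = replicate n 𝟙

1s-+ : ∀ m n → 1s (m + n) ≡ 1s m ++ 1s n
1s-+ zero    n = refl
1s-+ (suc m) n = cong (𝟙 ∷_) (1s-+ m n)

1s-injective : ∀ {m n} → 1s m ≡ 1s n → m ≡ n
1s-injective {m} {n} eq = trans (sym (length-replicate m)) (trans (cong length eq) (length-replicate n))

1s≢++𝟘∷ : ∀ r p {s} → 1s r ≢ p ++ 𝟘 ∷ s
1s≢++𝟘∷ zero    []      ()
1s≢++𝟘∷ zero    (_ ∷ _) ()
1s≢++𝟘∷ (suc r) []      ()
1s≢++𝟘∷ (suc r) (_ ∷ p) eq = 1s≢++𝟘∷ r p (∷-injectiveʳ eq)

1s≡++1s : ∀ q {r n} → 1s r ≡ q ++ 1s n → ∃[ d ] d + n ≡ r × q ≡ 1s d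
1s≡++1s []                eq = 0 , sym (1s-injective eq) , refl
1s≡++1s (_ ∷ q) {zero}    ()
1s≡++1s (_ ∷ q) {suc r}   eq with refl , eq′ ← ∷-injective eq
  with d , d+n≡r , refl ← 1s≡++1s q eq′ = suc d , cong suc d+n≡r , refl

++-𝟘∷1s-injective : ∀ p q {r m} → p ++ 𝟘 ∷ 1s r ≡ q ++ 𝟘 ∷ 1s m → p ≡ q × r ≡ m
++-𝟘∷1s-injective []      []      eq = refl , 1s-injective (∷-injectiveʳ eq)
++-𝟘∷1s-injective []      (_ ∷ q) eq = ⊥-elim (1s≢++𝟘∷ _ q (∷-injectiveʳ eq))
++-𝟘∷1s-injective (_ ∷ p) []      eq = ⊥-elim (1s≢++𝟘∷ _ p (sym (∷-injectiveʳ eq)))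
++-𝟘∷1s-injective (_ ∷ p) (_ ∷ q) eq with refl , eq′ ← ∷-injective eq
  with refl , r≡m ← ++-𝟘∷1s-injective p q eq′ = refl , r≡m

cut-trailing-1s : ∀ p q {r n} → p ++ 𝟘 ∷ 1s r ≡ q ++ 1s n → ∃[ d ] d + n ≡ r × q ≡ p ++ 𝟘 ∷ 1s d
cut-trailing-1s []      []      {n = zero}  ()
cut-trailing-1s []      []      {n = suc n} ()
cut-trailing-1s []      (_ ∷ q) eq with refl , eq′ ← ∷-injective eq
  with d , d+n≡r , refl ← 1s≡++1s q eq′ = d , d+n≡r , refl
cut-trailing-1s (a ∷ p) []      eq = ⊥-elim (1s≢++𝟘∷ _ (a ∷ p) (sym eq))
cut-trailing-1s (_ ∷ p) (_ ∷ q) eq with refl , eq′ ← ∷-injective eq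
  with d , d+n≡r , refl ← cut-trailing-1s p q eq′ = d , d+n≡r , refl

star-snoc : ∀ {L v u} → Star L v → L u → Star L (v ++ u)
star-snoc {L} {u = u} ε-mem lu = subst (Star L) (++-identityʳ u) (cat lu ε-mem)
star-snoc {L} {u = u} (cat {u′} {w} lu′ sw) lu =
  subst (Star L) (sym (++-assoc u′ w u)) (cat lu′ (star-snoc sw lu))

star-last : ∀ {L z} → Star L z → z ≡ [] ⊎ ∃₂ λ v u → Star L v × L u × z ≡ v ++ u
star-last ε-mem = inj₁ refl
star-last (cat {u} lu sw) with star-last sw
... | inj₁ refl                       = inj₂ ([] , u , ε-mem , lu , ++-identityʳ u)
... | inj₂ (v , u′ , sv , lu′ , refl) = inj₂ (u ++ v , u′ , cat lu sv , lu′ , sym (++-assoc u v u′))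

run-++ : ∀ {n} (D : DFA n) q u v → DFA.run D q (u ++ v) ≡ DFA.run D (DFA.run D q u) v
run-++ D q []      v = refl
run-++ D q (a ∷ u) v = run-++ D (DFA.δ D q a) u v

state-determines-future : ∀ {n L} (D : DFA n) → Recognises D L → ∀ {u v} →
                          DFA.run D (DFA.start D) u ≡ DFA.run D (DFA.start D) v →
                          ∀ {z} → L (u ++ z) → L (v ++ z)
state-determines-future D rec {u} {v} same {z} luz =
  Equivalence.to (rec (v ++ z))
    (subst (λ q → DFA.final D q ≡ true) same-end (Equivalence.from (rec (u ++ z)) luz))
  where
    open DFA D
    open ≡-Reasoning
    same-end : run start (u ++ z) ≡ run start (v ++ z)
    same-end = begin
      run start (u ++ z)   ≡⟨ run-++ D start u z ⟩
      run (run start u) z  ≡⟨ cong (λ q → run q z) same ⟩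
      run (run start v) z  ≡⟨ run-++ D start v z ⟨
      run start (v ++ z)   ∎

funToFin-cong : ∀ {m n} {f g : Fin m → Fin n} → f ≗ g → funToFin f ≡ funToFin g
funToFin-cong {zero}  _   = refl
funToFin-cong {suc m} f≗g = cong₂ combine (f≗g zero) (funToFin-cong (f≗g ∘ suc))

finToFun-injective : ∀ {m n} {x y : Fin (m ^ n)} → finToFun {m} {n} x ≗ finToFun y → x ≡ y
finToFun-injective {m} {n} {x} {y} eq =
  trans (sym (funToFin-finToFin {n} {m} x)) (trans (funToFin-cong {n} {m} eq) (funToFin-finToFin {n} {m} y))

bits-agree : ∀ {a b : Fin 2} → (a ≡ suc zero ⇔ b ≡ suc zero) → a ≡ b
bits-agree {zero}     {zero}     _ = refl
bits-agree {zero}     {suc zero} e with () ← Equivalence.from e refl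
bits-agree {suc zero} {zero}     e with () ← Equivalence.to e refl
bits-agree {suc zero} {suc zero} _ = refl

module _ (k : ℕ) where

  private
    t : ℕ
    t = suc (suc k)

  AcceptsOnes : Word → ℕ → Set
  AcceptsOnes w m = Star (S t) (w ++ 1s m)

  EndsWith𝟘 : Word → Set
  EndsWith𝟘 w = ∃[ u ] w ≡ u ++ 𝟘 ∷ []

  -- A y-piece may start at the final 𝟘 of w.
  OpensY : Word → Set
  OpensY w = ∃[ v ] Star (S t) v × w ≡ v ++ 𝟘 ∷ []

  block : ℕ → Word
  block r = 1s r ++ 𝟘 ∷ []

  block-++ : ∀ w r s → (w ++ block r) ++ s ≡ (w ++ 1s r) ++ 𝟘 ∷ s
  block-++ w r s = trans (++-assoc w (block r) s) (trans (cong (w ++_) (++-assoc (1s r) (𝟘 ∷ []) s))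
                     (sym (++-assoc w (1s r) (𝟘 ∷ s))))

  endsWith𝟘-block : ∀ w r → EndsWith𝟘 (w ++ block r)
  endsWith𝟘-block w r = w ++ 1s r , sym (++-assoc w (1s r) (𝟘 ∷ []))

  complement : ∀ {m} → m ≤ k → ∃[ a ] suc a + suc m ≡ t
  complement {m} m≤k with o , m+o≡k ← m≤n⇒∃[o]m+o≡n m≤k =
    o , cong suc (trans (+-suc o m) (cong suc (trans (+-comm o m) m+o≡k)))

  x-exponent : ∀ {a b} → suc a + suc b ≡ t → t ∸ b ∸ 1 ≡ suc a
  x-exponent {a} {b} eq = begin
    t ∸ b ∸ 1                ≡⟨ ∸-+-assoc t b 1 ⟩
    t ∸ (b + 1)              ≡⟨ cong (t ∸_) (+-comm b 1) ⟩
    t ∸ suc b                ≡⟨ cong (_∸ suc b) eq ⟨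
    suc a + suc b ∸ suc b    ≡⟨ m+n∸n≡m (suc a) (suc b) ⟩
    suc a                    ∎
    where open ≡-Reasoning

  x-piece : ∀ {a b} → suc a + suc b ≡ t → S t (1s (suc a) ++ 𝟘 ∷ 1s (suc b))
  x-piece {a} {b} eq = inj₂ (inj₂ (b , subst (suc b <_) eq (m<n+m (suc b) (s≤s z≤n)) ,
                                   cong (λ e → 1s e ++ 𝟘 ∷ 1s (suc b)) (sym (x-exponent eq))))

  data LastZero (p : Word) : ℕ → Set where
    zero-last : Star (S t) p → LastZero p 0
    y-last    : ∀ {v} → Star (S t) v → p ≡ v ++ 𝟘 ∷ 1s (suc k) → LastZero p 0
    x-last    : ∀ {v a b} → suc a + suc b ≡ t → Star (S t) v → p ≡ v ++ 1s (suc a) →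
                LastZero p (suc b)

  last-piece : ∀ {p c v u} → S t u → Star (S t) v → p ++ 𝟘 ∷ 1s c ≡ v ++ u → LastZero p c
  last-piece {p} {v = v} (inj₁ refl) sv e
    with refl , refl ← ++-𝟘∷1s-injective p v {m = 0} e = zero-last sv
  last-piece {p} {v = v} (inj₂ (inj₁ refl)) sv e
    with refl , refl ← ++-𝟘∷1s-injective p _ {m = 0}
                         (trans e (sym (++-assoc v (𝟘 ∷ 1s (suc k)) (𝟘 ∷ []))))
    = y-last sv refl
  last-piece {p} {v = v} (inj₂ (inj₂ (i , i<t , refl))) sv e
    with refl , refl ← ++-𝟘∷1s-injective p _
                         (trans e (sym (++-assoc v (1s (t ∸ i ∸ 1)) (𝟘 ∷ 1s (suc i)))))
    with a , a+i≡t ← complement (≤-pred (≤-pred i<t))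
    = x-last a+i≡t sv (cong (λ e → v ++ 1s e) (x-exponent a+i≡t))

  last-zero : ∀ {p c} → Star (S t) (p ++ 𝟘 ∷ 1s c) → LastZero p c
  last-zero {p} s with star-last s
  ... | inj₁ e with () ← ++-conicalʳ p _ e
  ... | inj₂ (v , u , sv , su , e) = last-piece su sv e

  accepts-block : ∀ {w a d r m} → AcceptsOnes w d → d + suc a ≡ r → suc a + suc m ≡ t →
                  AcceptsOnes (w ++ block r) (suc m)
  accepts-block {w} {a} {d} {r} {m} acc refl a+m≡t =
    subst (Star (S t)) split (star-snoc acc (x-piece a+m≡t))
    where
      open ≡-Reasoning
      split : (w ++ 1s d) ++ 1s (suc a) ++ 𝟘 ∷ 1s (suc m) ≡ (w ++ block r) ++ 1s (suc m)
      split = begin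
        (w ++ 1s d) ++ 1s (suc a) ++ 𝟘 ∷ 1s (suc m)    ≡⟨ ++-assoc (w ++ 1s d) (1s (suc a)) _ ⟨
        ((w ++ 1s d) ++ 1s (suc a)) ++ 𝟘 ∷ 1s (suc m)  ≡⟨ cong (_++ 𝟘 ∷ 1s (suc m)) (++-assoc w (1s d) _) ⟩
        (w ++ 1s d ++ 1s (suc a)) ++ 𝟘 ∷ 1s (suc m)    ≡⟨ cong (λ x → (w ++ x) ++ _) (1s-+ d (suc a)) ⟨
        (w ++ 1s r) ++ 𝟘 ∷ 1s (suc m)                  ≡⟨ block-++ w r (1s (suc m)) ⟨
        (w ++ block r) ++ 1s (suc m)                   ∎

  accepts-block⁻¹ : ∀ {w r m} → EndsWith𝟘 w → AcceptsOnes (w ++ block r) (suc m) →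
                    ∃₂ λ a d → d + suc a ≡ r × suc a + suc m ≡ t × AcceptsOnes w d
  accepts-block⁻¹ {w} {r} {m} (u , refl) acc
    with x-last {v} {a} a+m≡t sv w1≡v1 ← last-zero (subst (Star (S t)) (block-++ w r (1s (suc m))) acc)
    with d , d+a≡r , refl ← cut-trailing-1s u v (trans (sym (++-assoc u (𝟘 ∷ []) (1s r))) w1≡v1)
    = a , d , d+a≡r , a+m≡t , subst (Star (S t)) (sym (++-assoc u (𝟘 ∷ []) (1s d))) sv

  shift-gap : ∀ {a m} → suc a + suc m ≡ t → m + suc a ≡ suc k
  shift-gap {a} {m} a+m≡t =
    trans (+-suc m a) (trans (cong suc (+-comm m a)) (trans (sym (+-suc a m)) (suc-injective a+m≡t)))

  accepts-shift : ∀ {w m} → suc m < t → AcceptsOnes w m → AcceptsOnes (w ++ block (suc k)) (suc m)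
  accepts-shift m<t acc with a , a+m≡t ← complement (≤-pred (≤-pred m<t)) =
    accepts-block acc (shift-gap a+m≡t) a+m≡t

  accepts-shift⁻¹ : ∀ {w m} → EndsWith𝟘 w → AcceptsOnes (w ++ block (suc k)) (suc m) → AcceptsOnes w m
  accepts-shift⁻¹ {m = m} e acc with a , d , d+a≡r , a+m≡t , accd ← accepts-block⁻¹ e acc =
    subst (AcceptsOnes _) (+-cancelʳ-≡ (suc a) d m (trans d+a≡r (sym (shift-gap a+m≡t)))) accd

  accepts-wrap : ∀ {w} → AcceptsOnes w (suc k) → AcceptsOnes (w ++ block (suc k)) 0
  accepts-wrap {w} acc = subst (Star (S t)) (sym (block-++ w (suc k) [])) (star-snoc acc (inj₁ refl))

  accepts-clear : ∀ {w m} → suc m < t → AcceptsOnes w (suc m) → AcceptsOnes (w ++ block t) (suc m)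
  accepts-clear {m = m} m<t acc with a , a+m≡t ← complement (≤-pred (≤-pred m<t)) =
    accepts-block acc (trans (+-comm (suc m) (suc a)) a+m≡t) a+m≡t

  accepts-clear⁻¹ : ∀ {w m} → EndsWith𝟘 w → AcceptsOnes (w ++ block t) (suc m) → AcceptsOnes w (suc m)
  accepts-clear⁻¹ {m = m} e acc with a , d , d+a≡t , a+m≡t , accd ← accepts-block⁻¹ e acc =
    subst (AcceptsOnes _)
      (+-cancelʳ-≡ (suc a) d (suc m) (trans d+a≡t (trans (sym a+m≡t) (+-comm (suc a) (suc m))))) accd

  -- No factorisation can end in 𝟘 1^t, and 1^t 𝟘 is not the tail of a y-piece.
  rejects-clear-zero : ∀ {w} → EndsWith𝟘 w → ¬ AcceptsOnes (w ++ block t) 0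
  rejects-clear-zero {w} (u , refl) acc with last-zero (subst (Star (S t)) (block-++ w t []) acc)
  ... | zero-last sw with last-zero (subst (Star (S t)) (++-assoc u (𝟘 ∷ []) (1s t)) sw)
  ...   | x-last {a = a} a+t≡t _ _ = m+1+n≢n a (trans (+-suc a t) a+t≡t)
  rejects-clear-zero {w} (u , refl) acc | y-last {v} _ e
    with _ , t≡k ← ++-𝟘∷1s-injective u v (trans (sym (++-assoc u (𝟘 ∷ []) (1s t))) e) = 1+n≢n t≡k

  opensY-accepts : ∀ {w} → OpensY w → AcceptsOnes (w ++ block (suc k)) 0
  opensY-accepts (v , sv , refl) =
    subst (Star (S t)) (sym (trans (++-identityʳ _) (++-assoc v (𝟘 ∷ []) (block (suc k)))))
      (star-snoc sv (inj₂ (inj₁ refl)))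

  accepts-opensY : ∀ {w} → AcceptsOnes w (suc k) → OpensY (w ++ block (suc k))
  accepts-opensY {w} acc = w ++ 1s (suc k) , acc , sym (++-assoc w (1s (suc k)) (𝟘 ∷ []))

  shifted : ℕ → Word → Word
  shifted zero    w = w
  shifted (suc n) w = shifted n w ++ block (suc k)

  shifted-+ : ∀ m n w → shifted m (shifted n w) ≡ shifted (m + n) w
  shifted-+ zero    n w = refl
  shifted-+ (suc m) n w = cong (_++ block (suc k)) (shifted-+ m n w)

  accepts-shifted : ∀ n {w m} → n + m < t → AcceptsOnes w m → AcceptsOnes (shifted n w) (n + m)
  accepts-shifted zero    _   acc = acc
  accepts-shifted (suc n) n<t acc = accepts-shift n<t (accepts-shifted n (≤-trans (n≤1+n _) n<t) acc)

  -- t shift blocks move m up to t-1, wrap it around to 0 and move it back up to m.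
  accepts-cycle : ∀ {w m} → m < t → AcceptsOnes w m → AcceptsOnes (shifted t w) m
  accepts-cycle {w} {m} m<t acc with n , m+n≡k ← m≤n⇒∃[o]m+o≡n (≤-pred m<t) =
    subst₂ AcceptsOnes (trans (shifted-+ m (suc n) w) (cong (λ i → shifted i w) m+1+n≡t)) (+-identityʳ m)
      (accepts-shifted m (subst (_< t) (sym (+-identityʳ m)) m<t) (accepts-wrap top))
    where
      n+m≡k : n + m ≡ suc k
      n+m≡k = trans (+-comm n m) m+n≡k
      top : AcceptsOnes (shifted n w) (suc k)
      top = subst (AcceptsOnes _) n+m≡k (accepts-shifted n (subst (_< t) (sym n+m≡k) ≤-refl) acc)
      m+1+n≡t : m + suc n ≡ t
      m+1+n≡t = trans (+-suc m n) (cong suc m+n≡k)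

  round : Word → Word
  round w = shifted t (w ++ block (suc k))

  primer : ℕ → Word
  primer zero    = 𝟘 ∷ []
  primer (suc j) = round (primer j)

  primer-invariant : ∀ j → j ≤ t → OpensY (primer j) × (∀ m → m < j → AcceptsOnes (primer j) m)
  primer-invariant zero    _   = ([] , ε-mem , refl) , λ _ ()
  primer-invariant (suc j) j<t with opens , accepts ← primer-invariant j (≤-trans (n≤1+n j) j<t) =
    accepts-opensY top , new
    where
      top : AcceptsOnes (shifted (suc k) (primer j ++ block (suc k))) (suc k)
      top = subst (AcceptsOnes _) (+-identityʳ (suc k))
              (accepts-shifted (suc k) (subst (_< t) (sym (+-identityʳ (suc k))) ≤-refl) (opensY-accepts opens))
      new : ∀ m → m < suc j → AcceptsOnes (round (primer j)) m
      new zero    _         = accepts-wrap top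
      new (suc m) (s≤s m<j) = accepts-cycle m<t (accepts-shift m<t (accepts m m<j))
        where
          m<t : suc m < t
          m<t = s≤s (≤-trans m<j (≤-pred j<t))

  push : Fin 2 → Word → Word
  push zero       w = (w ++ block (suc k)) ++ block t
  push (suc zero) w = w ++ block (suc k)

  push-endsWith𝟘 : ∀ b w → EndsWith𝟘 (push b w)
  push-endsWith𝟘 zero       w = endsWith𝟘-block (w ++ block (suc k)) t
  push-endsWith𝟘 (suc zero) w = endsWith𝟘-block w (suc k)

  push-accepts-suc : ∀ b {w m} → suc m < t → AcceptsOnes w m → AcceptsOnes (push b w) (suc m)
  push-accepts-suc zero       m<t acc = accepts-clear m<t (accepts-shift m<t acc)
  push-accepts-suc (suc zero) m<t acc = accepts-shift m<t acc

  push-accepts-suc⁻¹ : ∀ b {w m} → EndsWith𝟘 w → AcceptsOnes (push b w) (suc m) → AcceptsOnes w m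
  push-accepts-suc⁻¹ zero       {w} e acc =
    accepts-shift⁻¹ e (accepts-clear⁻¹ (endsWith𝟘-block w (suc k)) acc)
  push-accepts-suc⁻¹ (suc zero)     e acc = accepts-shift⁻¹ e acc

  encode : ∀ {n} → (Fin n → Fin 2) → Word
  encode {zero}  _ = primer t
  encode {suc n} f = push (f zero) (encode (f ∘ suc))

  encode-endsWith𝟘 : ∀ {n} (f : Fin n → Fin 2) → EndsWith𝟘 (encode f)
  encode-endsWith𝟘 {zero}  _ with v , _ , e ← proj₁ (primer-invariant t ≤-refl) = v , e
  encode-endsWith𝟘 {suc n} f = push-endsWith𝟘 (f zero) _

  encode-accepts-high : ∀ {n} (f : Fin n → Fin 2) {m} → n < m → m < t → AcceptsOnes (encode f) m
  encode-accepts-high {zero}  f         _         m<t = proj₂ (primer-invariant t ≤-refl) _ m<t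
  encode-accepts-high {suc n} f {suc m} (s≤s n<m) m<t =
    push-accepts-suc (f zero) m<t (encode-accepts-high (f ∘ suc) n<m (≤-trans (n≤1+n _) m<t))

  encode-accepts⇔ : ∀ {n} → n ≤ suc k → (f : Fin n → Fin 2) (j : Fin n) →
                    AcceptsOnes (encode f) (toℕ j) ⇔ f j ≡ suc zero
  encode-accepts⇔ {suc n} n≤1+k f zero with f zero
  ... | zero     = mk⇔ (⊥-elim ∘ rejects-clear-zero (endsWith𝟘-block (encode (f ∘ suc)) (suc k))) λ ()
  ... | suc zero = mk⇔ (λ _ → refl) (λ _ → accepts-wrap (encode-accepts-high (f ∘ suc) n≤1+k ≤-refl))
  encode-accepts⇔ {suc n} n≤1+k f (suc j) =
    ⇔-trans (mk⇔ (push-accepts-suc⁻¹ (f zero) (encode-endsWith𝟘 (f ∘ suc)))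
                 (push-accepts-suc (f zero) j<t))
            (encode-accepts⇔ (≤-trans (n≤1+n n) n≤1+k) (f ∘ suc) j)
    where
      j<t : suc (toℕ j) < t
      j<t = m<n⇒m<1+n (<-≤-trans (toℕ<n (suc j)) n≤1+k)

  encode-states-injective : ∀ {n} (D : DFA n) → Recognises D (Star (S t)) →
                            (f g : Fin (suc k) → Fin 2) →
                            DFA.run D (DFA.start D) (encode f) ≡ DFA.run D (DFA.start D) (encode g) →
                            f ≗ g
  encode-states-injective D rec f g same j = bits-agree {f j} {g j}
    (⇔-trans (⇔-sym (encode-accepts⇔ ≤-refl f j))
      (⇔-trans (mk⇔ (state-determines-future D rec {encode f} {encode g} same)
                    (state-determines-future D rec {encode g} {encode f} (sym same)))
               (encode-accepts⇔ ≤-refl g j)))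

  sc-lower-bound : ScAtLeast (Star (S t)) (2 ^ suc k)
  sc-lower-bound n D rec = injective⇒≤ {f = state} λ {x} {y} same →
    finToFun-injective (encode-states-injective D rec (bits x) (bits y) same)
    where
      bits : Fin (2 ^ suc k) → Fin (suc k) → Fin 2
      bits = finToFun
      state : Fin (2 ^ suc k) → Fin n
      state x = DFA.run D (DFA.start D) (encode (bits x))

theorem8 : (t : ℕ) → 2 ≤ t → ScAtLeast (Star (S t)) (2 ^ (t ∸ 2))
theorem8 (suc (suc k)) _ n D rec = ≤-trans (^-monoʳ-≤ 2 (n≤1+n k)) (sc-lower-bound k n D rec)
theorem8 (suc zero)    (s≤s ())
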